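{- Let $n\ge 3$ and $K=\{2,\ldots,n-1\}$. Then $\mathcal{D}(S_K)=F_K$, and this domain equals the classical single-peaked domain, i.e. the set of all linear orders on $[n]$ that are single-peaked with respect to the axis $1\triangleleft 2\triangleleft\cdots\triangleleft n$.
   Context: $[n]=\{1,\ldots,n\}$. For $K\subseteq\{2,\ldots,n-1\}$, the generalised Fishburn domain $F_K$ is the set of all linear orders $v$ on $[n]$ such that for all $1\le i<j<k\le n$: if $j\in K$ then $j$ is not ranked last by $v$ among $\{i,j,k\}$, and if $j\notin K$ then $j$ is not ranked first by $v$ among $\{i,j,k\}$. Necklace $S_K$: let $L=\{2,\ldots,n-1\}\setminus K$, with elements $k_1<\cdots<k_s$ of $K$ and $\ell_1<\cdots<\ell_t$ of $L$. Place the numbers $1,\ldots,n$ ("beads") on a circle in the cyclic order $1, k_1,\ldots,k_s, n, \ell_t,\ldots,\ell_1$ (then back to $1$); beads $1,k_1,\ldots,k_s,n$ are white and $\ell_1,\ldots,\ell_t$ are black. A set $X\subseteq[n]$ is $w$-convex if (1) $X$ is an arc (contiguous set) of this circle, (2) $X$ is not a single black bead, and (3) there are no integers $i<j<k$ with $i,k\in X$, $j\notin X$ and $j$ white. A flag of $w$-convex sets is a chain $X_1\subset X_2\subset\cdots\subset X_n=[n]$ of $w$-convex sets with $|X_k|=k$; it defines the linear order $x_1x_2\ldots x_n$ (ranked from top) where $\{x_i\}=X_i\setminus X_{i-1}$, $X_0=\emptyset$. $\mathcal{D}(S_K)$ is the set of all linear orders arising from flags of $w$-convex sets. A linear order $v$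 is single-peaked with respect to an axis $a_1\triangleleft\cdots\triangleleft a_n$ if for every $a$ the upper contour set $\{b: b\succ_v a\}$ is an interval of the axis. -}

module Defs where

open import Data.Nat using (ℕ; zero; suc; _+_; _∸_; _≤_; _<_; _≤ᵇ_)
open import Data.Bool using (Bool; true; false; T; not; _∧_)
open import Data.List using (List; []; _∷_; _++_; map; upTo; filter; reverse; take; drop; length; lookup)
open import Data.List.Membership.Propositional using (_∈_)
open import Data.List.Relation.Binary.Permutation.Propositional using (_↭_)
open import Data.Fin using (Fin; toℕ)
open import Data.Product using (Σ; _×_; _,_)
open import Relation.Binary.PropositionalEquality using (_≡_)
open import Relation.Nullary using (¬_)
open import Relation.Nullary.Decidable using (T?)

[_] : ℕ → List ℕ
[ n ] = map suc (upTo n)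

InRange : ℕ → ℕ → Set
InRange n x = 1 ≤ x × x ≤ n

-- Linear orders on [n]: a list ranking all elements from top to bottom

IsLinOrder : ℕ → List ℕ → Set
IsLinOrder n v = v ↭ [ n ]

_≻[_]_ : ℕ → List ℕ → ℕ → Set
a ≻[ v ] b = Σ (List ℕ) λ xs → Σ (List ℕ) λ ys → (v ≡ xs ++ (a ∷ ys)) × (b ∈ ys)

-- Generalised Fishburn domain F_K  (K given as a Boolean predicate on ℕ;
-- only its values on {2,…,n-1} matter)

InFishburn : ℕ → (ℕ → Bool) → List ℕ → Set
InFishburn n K v =
  IsLinOrder n v ×
  (∀ i j k → 1 ≤ i → i < j → j < k → k ≤ n →
     (T (K j) → ¬ ((i ≻[ v ] j) × (k ≻[ v ] j))) ×
     (¬ T (K j) → ¬ ((j ≻[ v ] i) × (j ≻[ v ] k))))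

middle : ℕ → List ℕ
middle n = map (λ j → 2 + j) (upTo (n ∸ 2))

-- the beads in cyclic order 1, k₁,…,k_s, n, ℓ_t,…,ℓ₁
necklace : ℕ → (ℕ → Bool) → List ℕ
necklace n K =
  1 ∷ (filter (λ j → T? (K j)) (middle n) ++
       (n ∷ reverse (filter (λ j → T? (not (K j))) (middle n))))

Black : ℕ → (ℕ → Bool) → ℕ → Set
Black n K b = 2 ≤ b × suc b ≤ n × ¬ T (K b)

White : ℕ → (ℕ → Bool) → ℕ → Set
White n K w = InRange n w × ¬ Black n K w

-- subsets of [n] are represented by Boolean predicates (only values on [n] matter)
SubsetN : Set
SubsetN = ℕ → Bool

-- the arc of the circle c of length l starting at position s
window : List ℕ → ℕ → ℕ → List ℕ
window c s l = take l (drop s (c ++ c))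

IsArc : ℕ → (ℕ → Bool) → SubsetN → Set
IsArc n K X =
  Σ ℕ λ s → Σ ℕ λ l → s < n × l ≤ n ×
    (∀ x → InRange n x →
       (T (X x) → x ∈ window (necklace n K) s l) ×
       (x ∈ window (necklace n K) s l → T (X x)))

IsWConvex : ℕ → (ℕ → Bool) → SubsetN → Set
IsWConvex n K X =
  IsArc n K X ×
  (¬ (Σ ℕ λ b → Black n K b × (∀ x → InRange n x → (T (X x) → x ≡ b) × (x ≡ b → T (X x))))) ×
  (∀ i j k → i < j → j < k → InRange n i → InRange n k →
     T (X i) → T (X k) → White n K j → T (X j))

card : ℕ → SubsetN → ℕ
card n X = length (filter (λ x → T? (X x)) [ n ])

record Flag (n : ℕ) (K : ℕ → Bool) : Set where
  field
    X        : ℕ → SubsetN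
    empty₀   : ∀ x → X 0 x ≡ false
    chain    : ∀ k x → k < n → InRange n x → T (X k x) → T (X (suc k) x)
    size     : ∀ k → 1 ≤ k → k ≤ n → card n (X k) ≡ k
    convex   : ∀ k → 1 ≤ k → k ≤ n → IsWConvex n K (X k)
    full     : ∀ x → InRange n x → T (X n x)

-- the linear order x₁x₂…x_n defined by a flag: {x_i} = X_i \ X_{i-1}
DefinesOrder : ∀ {n K} → Flag n K → List ℕ → Set
DefinesOrder {n} F v =
  length v ≡ n ×
  (∀ (i : Fin (length v)) →
     let x = lookup v i in
     InRange n x × T (Flag.X F (suc (toℕ i)) x) × ¬ T (Flag.X F (toℕ i) x))

InD : ℕ → (ℕ → Bool) → List ℕ → Set
InD n K v = Σ (Flag n K) λ F → DefinesOrder F v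

IsIntervalOfAxis : (ℕ → Set) → Set
IsIntervalOfAxis P = ∀ b c d → b < c → c < d → P b → P d → P c

SinglePeaked : ℕ → List ℕ → Set
SinglePeaked n v =
  IsLinOrder n v × (∀ a → InRange n a → IsIntervalOfAxis (λ b → b ≻[ v ] a))

Kfull : ℕ → ℕ → Bool
Kfull n j = (2 ≤ᵇ j) ∧ (suc j ≤ᵇ n)

{-# OPTIONS --safe #-}
-- For K = {2,…,n-1} every bead is white and the necklace is the axis 1 ◁ 2 ◁ ⋯ ◁ n itself, so the
-- w-convex sets are the nonempty intervals of the axis. Membership in F_K and single-peakedness both
-- say that the order has no valley: no j is ranked below some i < j and some k > j. A flag of
-- intervals produces no valley, because the first of its sets containing i and k already contains j.
-- Conversely every prefix of a valley-free order is axis-convex, hence an interval, so the prefixes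
-- form a flag of w-convex sets defining the order.
module Submission where

open import Defs
open import Data.Nat using (ℕ; zero; suc; _+_; _∸_; _⊔_; _⊓_; _≤_; _<_; z≤n; s≤s; z<s; _≟_)
open import Data.Nat.Properties
open import Data.Bool using (T; not)
open import Data.Bool.Properties using (T-∧; T-not-≡)
open import Data.List using (List; []; _∷_; _++_; take; drop; filter; reverse; length; lookup; applyUpTo)
open import Data.List.Properties using (map-applyUpTo; filter-all; filter-none; take-all; length-take; take++drop≡id)
open import Data.List.Membership.Propositional using (_∈_; _∉_)
open import Data.List.Membership.Propositional.Properties
  using (∈-∃++; ∈-++⁺ˡ; ∈-++⁺ʳ; ∈-++⁻; ∈-lookup; ∈-filter⁺; ∈-filter⁻)
open import Data.List.Membership.DecPropositional _≟_ using (_∈?_)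
open import Data.List.Relation.Binary.Subset.Propositional using (_⊆_)
open import Data.List.Relation.Unary.Any using (here; there; index)
open import Data.List.Relation.Unary.Any.Properties using (lookup-index)
open import Data.List.Relation.Unary.All using (All; _∷_)
import Data.List.Relation.Unary.All as All
open import Data.List.Relation.Unary.All.Properties using (¬Any⇒All¬; All¬⇒¬Any)
open import Data.List.Relation.Unary.Unique.Propositional using (Unique; []; _∷_; tail)
import Data.List.Relation.Unary.Unique.Propositional.Properties as Unique
open import Data.List.Relation.Binary.Permutation.Propositional using (_↭_; ↭-sym; ↭⇒↭ₛ)
open import Data.List.Relation.Binary.Permutation.Setoid.Properties using (Unique-resp-↭)
open import Data.List.Relation.Binary.Permutation.Propositional.Properties using (↭-length; ∈-resp-↭; shift)
open import Data.List.Relation.Binary.BagAndSetEquality using (∼bag⇒↭)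
open import Data.List.Membership.Propositional.Properties.WithK using (unique∧set⇒bag)
import Data.List.Extrema ≤-totalOrder as Extrema
open import Data.Fin using (Fin; toℕ; fromℕ<) renaming (zero to fzero; suc to fsuc)
open import Data.Fin.Properties using (toℕ<n; toℕ-fromℕ<)
open import Data.Product using (Σ; ∃-syntax; _×_; _,_; proj₁; proj₂)
open import Data.Sum using (_⊎_; inj₁; inj₂; [_,_]′)
open import Relation.Binary.PropositionalEquality
  using (_≡_; _≢_; setoid; refl; sym; trans; cong; cong₂; subst; module ≡-Reasoning)
open import Relation.Nullary using (¬_; Dec; yes; no; contradiction)
open import Data.Empty using (⊥; ⊥-elim)
open import Relation.Nullary.Decidable using (isYes; T?; toWitness; fromWitness)
open import Function.Bundles using (_⇔_; mk⇔; Equivalence)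
import Function.Properties.Equivalence as ⇔
open import Function.Base using (id; _∘_)

Unique-head : ∀ {x : ℕ} {xs} → Unique (x ∷ xs) → x ∉ xs
Unique-head (x≢xs ∷ _) = All¬⇒¬Any x≢xs

Unique-cons : ∀ {x : ℕ} {xs} → x ∉ xs → Unique xs → Unique (x ∷ xs)
Unique-cons x∉xs uxs = ¬Any⇒All¬ _ x∉xs ∷ uxs

length-mono-⊆ : ∀ {xs ys : List ℕ} → Unique xs → xs ⊆ ys → length xs ≤ length ys
length-mono-⊆ {[]} _ _ = z≤n
length-mono-⊆ {x ∷ xs} {ys} uxxs xxs⊆ys with as , bs , refl ← ∈-∃++ (xxs⊆ys (here refl)) =
  ≤-trans (s≤s (length-mono-⊆ (tail uxxs) xs⊆as++bs)) (≤-reflexive (↭-length (↭-sym (shift x as bs))))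
  where
  xs⊆as++bs : xs ⊆ as ++ bs
  xs⊆as++bs y∈xs with ∈-resp-↭ (shift x as bs) (xxs⊆ys (there y∈xs))
  ... | here refl = contradiction y∈xs (Unique-head uxxs)
  ... | there y∈as++bs = y∈as++bs

⊆∧length≤⇒⊇ : ∀ {xs ys : List ℕ} → Unique xs → xs ⊆ ys → length ys ≤ length xs → ys ⊆ xs
⊆∧length≤⇒⊇ {xs} uxs xs⊆ys ys≤xs {y} y∈ys with y ∈? xs
... | yes y∈xs = y∈xs
... | no y∉xs = contradiction (length-mono-⊆ (Unique-cons y∉xs uxs) yxs⊆ys) (<⇒≱ (s≤s ys≤xs))
  where
  yxs⊆ys : y ∷ xs ⊆ _
  yxs⊆ys (here refl) = y∈ys
  yxs⊆ys (there z∈xs) = xs⊆ys z∈xs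

lookup-injective⇒Unique : ∀ (v : List ℕ) →
  (∀ i j → toℕ i < toℕ j → lookup v i ≢ lookup v j) → Unique v
lookup-injective⇒Unique [] _ = []
lookup-injective⇒Unique (x ∷ v) injective =
  Unique-cons (λ x∈v → injective fzero (fsuc (index x∈v)) z<s (lookup-index x∈v))
              (lookup-injective⇒Unique v (λ i j i<j → injective (fsuc i) (fsuc j) (s≤s i<j)))

⊆∧⊇⇒↭ : ∀ {xs ys : List ℕ} → Unique xs → Unique ys → xs ⊆ ys → ys ⊆ xs → xs ↭ ys
⊆∧⊇⇒↭ uxs uys xs⊆ys ys⊆xs = ∼bag⇒↭ (unique∧set⇒bag uxs uys (mk⇔ xs⊆ys ys⊆xs))

range : ℕ → ℕ → List ℕ
range a zero = []
range a (suc m) = a ∷ range (suc a) m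

∈-range⁻ : ∀ {x} a m → x ∈ range a m → a ≤ x × x < a + m
∈-range⁻ a (suc m) (here refl) = ≤-refl , m<m+n a z<s
∈-range⁻ {x} a (suc m) (there x∈) with a<x , x<a+m ← ∈-range⁻ (suc a) m x∈ =
  <⇒≤ a<x , subst (x <_) (sym (+-suc a m)) x<a+m

∈-range⁺ : ∀ {x} a m → a ≤ x → x < a + m → x ∈ range a m
∈-range⁺ a zero a≤x x<a+0 = contradiction (subst (_ <_) (+-identityʳ a) x<a+0) (≤⇒≯ a≤x)
∈-range⁺ {x} a (suc m) a≤x x<a+m with a ≟ x
... | yes refl = here refl
... | no a≢x = there (∈-range⁺ (suc a) m (≤∧≢⇒< a≤x a≢x) (subst (x <_) (+-suc a m) x<a+m))

range-unique : ∀ a m → Unique (range a m)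
range-unique a zero = []
range-unique a (suc m) =
  Unique-cons (λ a∈ → <-irrefl refl (proj₁ (∈-range⁻ (suc a) m a∈))) (range-unique (suc a) m)

length-range : ∀ a m → length (range a m) ≡ m
length-range a zero = refl
length-range a (suc m) = cong suc (length-range (suc a) m)

range-∷ʳ : ∀ a m → range a m ++ (a + m) ∷ [] ≡ range a (suc m)
range-∷ʳ a zero = cong (_∷ []) (+-identityʳ a)
range-∷ʳ a (suc m) =
  cong (a ∷_) (trans (cong (λ b → range (suc a) m ++ b ∷ []) (+-suc a m)) (range-∷ʳ (suc a) m))

applyUpTo≡range : ∀ (f : ℕ → ℕ) a m → (∀ i → f i ≡ a + i) → applyUpTo f m ≡ range a m
applyUpTo≡range f a zero _ = refl
applyUpTo≡range f a (suc m) f≗a+ =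
  cong₂ _∷_ (trans (f≗a+ 0) (+-identityʳ a))
            (applyUpTo≡range (f ∘ suc) (suc a) m (λ i → trans (f≗a+ (suc i)) (+-suc a i)))

take-drop-range : ∀ a m s l (ys : List ℕ) → s + l ≤ m → take l (drop s (range a m ++ ys)) ≡ range (a + s) l
take-drop-range a m zero l ys l≤m = trans (take-range m l l≤m) (cong (λ b → range b l) (sym (+-identityʳ a)))
  where
  take-range : ∀ {a} m l → l ≤ m → take l (range a m ++ ys) ≡ range a l
  take-range m zero _ = refl
  take-range (suc m) (suc l) (s≤s l≤m) = cong (_ ∷_) (take-range m l l≤m)
take-drop-range a (suc m) (suc s) l ys (s≤s s+l≤m) =
  trans (take-drop-range (suc a) m s l ys s+l≤m) (cong (λ b → range b l) (sym (+-suc a s)))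

[n]≡range : ∀ n → [ n ] ≡ range 1 n
[n]≡range n = trans (map-applyUpTo id suc n) (applyUpTo≡range suc 1 n (λ _ → refl))

middle≡range : ∀ n → middle n ≡ range 2 (n ∸ 2)
middle≡range n = trans (map-applyUpTo id (2 +_) (n ∸ 2)) (applyUpTo≡range (2 +_) 2 (n ∸ 2) (λ _ → refl))

Kfull-middle : ∀ {n j} → 2 ≤ j → suc j ≤ n → T (Kfull n j)
Kfull-middle 2≤j j<n = Equivalence.from T-∧ (≤⇒≤ᵇ 2≤j , ≤⇒≤ᵇ j<n)

Kfull-noBlack : ∀ {n b} → ¬ Black n (Kfull n) b
Kfull-noBlack (2≤b , b<n , b∉K) = b∉K (Kfull-middle 2≤b b<n)

Kfull-white : ∀ {n j} → InRange n j → White n (Kfull n) j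
Kfull-white j∈[n] = j∈[n] , Kfull-noBlack

necklace-Kfull : ∀ n → 2 ≤ n → necklace n (Kfull n) ≡ range 1 n
necklace-Kfull n@(suc (suc k)) (s≤s (s≤s z≤n)) = begin
  1 ∷ (filter K? (middle n) ++ n ∷ reverse (filter L? (middle n)))
    ≡⟨ cong₂ (λ ks ls → 1 ∷ (ks ++ n ∷ reverse ls)) (filter-all K? allK) (filter-none L? allNotL) ⟩
  1 ∷ (middle n ++ n ∷ [])
    ≡⟨ cong (λ ks → 1 ∷ (ks ++ n ∷ [])) (middle≡range n) ⟩
  1 ∷ (range 2 k ++ (2 + k) ∷ [])
    ≡⟨ cong (1 ∷_) (range-∷ʳ 2 k) ⟩
  range 1 n ∎
  where
  open ≡-Reasoning
  K? = λ j → T? (Kfull n j)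
  L? = λ j → T? (not (Kfull n j))
  middle-K : ∀ {j} → j ∈ middle n → T (Kfull n j)
  middle-K j∈ with 2≤j , j<n ← ∈-range⁻ 2 k (subst (_ ∈_) (middle≡range n) j∈) = Kfull-middle 2≤j j<n
  allK : All (λ j → T (Kfull n j)) (middle n)
  allK = All.tabulate middle-K
  allNotL : All (λ j → ¬ T (not (Kfull n j))) (middle n)
  allNotL = All.tabulate λ j∈ notK → subst T (Equivalence.to T-not-≡ notK) (middle-K j∈)

∈[n]⁻ : ∀ {n x} → x ∈ [ n ] → InRange n x
∈[n]⁻ {n} x∈ with 1≤x , s≤s x≤n ← ∈-range⁻ 1 n (subst (_ ∈_) ([n]≡range n) x∈) = 1≤x , x≤n

∈[n]⁺ : ∀ {n x} → InRange n x → x ∈ [ n ]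
∈[n]⁺ {n} (1≤x , x≤n) = subst (_ ∈_) (sym ([n]≡range n)) (∈-range⁺ 1 n 1≤x (s≤s x≤n))

[n]-unique : ∀ n → Unique [ n ]
[n]-unique n = subst Unique (sym ([n]≡range n)) (range-unique 1 n)

length-[n] : ∀ n → length [ n ] ≡ n
length-[n] n = trans (cong length ([n]≡range n)) (length-range 1 n)

module LinOrder {n v} (lin : IsLinOrder n v) where

  unique : Unique v
  unique = Unique-resp-↭ (setoid ℕ) (↭⇒↭ₛ (↭-sym lin)) ([n]-unique n)

  inRange : ∀ {x} → x ∈ v → InRange n x
  inRange x∈v = ∈[n]⁻ (∈-resp-↭ lin x∈v)

  complete : ∀ {x} → InRange n x → x ∈ v
  complete x∈[n] = ∈-resp-↭ (↭-sym lin) (∈[n]⁺ x∈[n])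

  length≡ : length v ≡ n
  length≡ = trans (↭-length lin) (length-[n] n)

unique∧length⇒IsLinOrder : ∀ {n v} → Unique v → (∀ {x} → x ∈ v → InRange n x) → length v ≡ n →
  IsLinOrder n v
unique∧length⇒IsLinOrder {n} {v} uv v⊆[n] |v|≡n = ⊆∧⊇⇒↭ uv ([n]-unique n) (∈[n]⁺ ∘ v⊆[n])
  (⊆∧length≤⇒⊇ uv (∈[n]⁺ ∘ v⊆[n]) (≤-reflexive (trans (length-[n] n) (sym |v|≡n))))

take-mono : ∀ {k m} (v : List ℕ) → k ≤ m → take k v ⊆ take m v
take-mono {suc k} {suc m} (x ∷ v) (s≤s k≤m) (here refl) = here refl
take-mono {suc k} {suc m} (x ∷ v) (s≤s k≤m) (there y∈) = there (take-mono v k≤m y∈)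

lookup∈take : ∀ (v : List ℕ) i {k} → toℕ i < k → lookup v i ∈ take k v
lookup∈take (x ∷ v) fzero {suc k} _ = here refl
lookup∈take (x ∷ v) (fsuc i) {suc k} (s≤s i<k) = there (lookup∈take v i i<k)

lookup∉take : ∀ {v : List ℕ} → Unique v → ∀ i → lookup v i ∉ take (toℕ i) v
lookup∉take {x ∷ v} uv (fsuc i) (here vi≡x) = Unique-head uv (subst (_∈ v) vi≡x (∈-lookup i))
lookup∉take {x ∷ v} uv (fsuc i) (there vi∈) = lookup∉take (tail uv) i vi∈

take-⊆ : ∀ m (v : List ℕ) → take m v ⊆ v
take-⊆ m v x∈ = subst (_ ∈_) (take++drop≡id m v) (∈-++⁺ˡ x∈)

drop-⊆ : ∀ m (v : List ℕ) → drop m v ⊆ v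
drop-⊆ m v x∈ = subst (_ ∈_) (take++drop≡id m v) (∈-++⁺ʳ (take m v) x∈)

data Before : List ℕ → ℕ → ℕ → Set where
  before-head : ∀ {a b v} → b ∈ v → Before (a ∷ v) a b
  before-tail : ∀ {x a b v} → Before v a b → Before (x ∷ v) a b

≻⇒Before : ∀ {v a b} → a ≻[ v ] b → Before v a b
≻⇒Before (xs , ys , refl , b∈ys) = go xs
  where
  go : ∀ xs → Before (xs ++ _ ∷ ys) _ _
  go [] = before-head b∈ys
  go (x ∷ xs) = before-tail (go xs)

Before⇒≻ : ∀ {v a b} → Before v a b → a ≻[ v ] b
Before⇒≻ (before-head {v = v} b∈v) = [] , v , refl , b∈v
Before⇒≻ (before-tail {x = x} a↑b) with xs , ys , refl , b∈ys ← Before⇒≻ a↑b = x ∷ xs , ys , refl , b∈ys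

Before-∈ˡ : ∀ {v a b} → Before v a b → a ∈ v
Before-∈ˡ (before-head _) = here refl
Before-∈ˡ (before-tail a↑b) = there (Before-∈ˡ a↑b)

Before-∈ʳ : ∀ {v a b} → Before v a b → b ∈ v
Before-∈ʳ (before-head b∈v) = there b∈v
Before-∈ʳ (before-tail a↑b) = there (Before-∈ʳ a↑b)

Before-irrefl : ∀ {v a} → Unique v → ¬ Before v a a
Before-irrefl uv (before-head a∈v) = Unique-head uv a∈v
Before-irrefl uv (before-tail a↑a) = Before-irrefl (tail uv) a↑a

Before-trans : ∀ {v a b c} → Unique v → Before v a b → Before v b c → Before v a c
Before-trans uv (before-head b∈v) (before-head _) = contradiction b∈v (Unique-head uv)
Before-trans uv (before-head _) (before-tail b↑c) = before-head (Before-∈ʳ b↑c)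
Before-trans uv (before-tail a↑b) (before-head _) = contradiction (Before-∈ʳ a↑b) (Unique-head uv)
Before-trans uv (before-tail a↑b) (before-tail b↑c) = before-tail (Before-trans (tail uv) a↑b b↑c)

Before-total : ∀ {v a b} → a ∈ v → b ∈ v → a ≢ b → Before v a b ⊎ Before v b a
Before-total (here refl) (here refl) a≢b = contradiction refl a≢b
Before-total (here refl) (there b∈v) _ = inj₁ (before-head b∈v)
Before-total (there a∈v) (here refl) _ = inj₂ (before-head a∈v)
Before-total (there a∈v) (there b∈v) a≢b with Before-total a∈v b∈v a≢b
... | inj₁ a↑b = inj₁ (before-tail a↑b)
... | inj₂ b↑a = inj₂ (before-tail b↑a)

take-drop⇒Before : ∀ {a b} m v → a ∈ take m v → b ∈ drop m v → Before v a b
take-drop⇒Before (suc m) (x ∷ v) (here refl) b∈ = before-head (drop-⊆ m v b∈)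
take-drop⇒Before (suc m) (x ∷ v) (there a∈) b∈ = before-tail (take-drop⇒Before m v a∈ b∈)

Before⇒positions : ∀ {v a b} → Before v a b →
  Σ (Fin (length v)) λ i → Σ (Fin (length v)) λ j → toℕ i < toℕ j × lookup v i ≡ a × lookup v j ≡ b
Before⇒positions (before-head b∈v) = fzero , fsuc (index b∈v) , z<s , refl , sym (lookup-index b∈v)
Before⇒positions (before-tail a↑b) with i , j , i<j , vi≡a , vj≡b ← Before⇒positions a↑b =
  fsuc i , fsuc j , s≤s i<j , vi≡a , vj≡b

ValleyFree : ℕ → List ℕ → Set
ValleyFree n v = ∀ {i j k} → 1 ≤ i → i < j → j < k → k ≤ n → ¬ (i ≻[ v ] j × k ≻[ v ] j)

InFishburn-Kfull⇔ValleyFree : ∀ {n v} → InFishburn n (Kfull n) v ⇔ (IsLinOrder n v × ValleyFree n v)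
InFishburn-Kfull⇔ValleyFree {n} = mk⇔
  (λ (lin , fishburn) → lin , λ 1≤i i<j j<k k≤n →
    proj₁ (fishburn _ _ _ 1≤i i<j j<k k≤n) (j∈K 1≤i i<j j<k k≤n))
  (λ (lin , valleyFree) → lin , λ _ _ _ 1≤i i<j j<k k≤n →
    (λ _ → valleyFree 1≤i i<j j<k k≤n) , (λ j∉K → contradiction (j∈K 1≤i i<j j<k k≤n) j∉K))
  where
  j∈K : ∀ {i j k} → 1 ≤ i → i < j → j < k → k ≤ n → T (Kfull n j)
  j∈K 1≤i i<j j<k k≤n = Kfull-middle (≤-trans (s≤s 1≤i) i<j) (≤-trans j<k k≤n)

SinglePeaked⇔ValleyFree : ∀ {n v} → SinglePeaked n v ⇔ (IsLinOrder n v × ValleyFree n v)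
SinglePeaked⇔ValleyFree {n} {v} = mk⇔
  (λ (lin , singlePeaked) → lin , λ {_} {j} 1≤i i<j j<k k≤n (i≻j , k≻j) →
    let j∈[n] = ≤-trans 1≤i (<⇒≤ i<j) , ≤-trans (<⇒≤ j<k) k≤n in
    Before-irrefl (LinOrder.unique lin) (≻⇒Before (singlePeaked j j∈[n] _ _ _ i<j j<k i≻j k≻j)))
  (λ (lin , valleyFree) → lin , λ a a∈[n] b c d b<c c<d b≻a d≻a →
    Before⇒≻ (upper-convex lin valleyFree a∈[n] b<c c<d (≻⇒Before b≻a) (≻⇒Before d≻a)))
  where
  upper-convex : IsLinOrder n v → ValleyFree n v → ∀ {a b c d} → InRange n a → b < c → c < d →
    Before v b a → Before v d a → Before v c a
  upper-convex lin valleyFree {a} {b} {c} {d} a∈[n] b<c c<d b↑a d↑a = by-cases (c ≟ a)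
    where
    open LinOrder lin
    1≤b = proj₁ (inRange (Before-∈ˡ b↑a))
    d≤n = proj₂ (inRange (Before-∈ˡ d↑a))
    c∈[n] : InRange n c
    c∈[n] = ≤-trans 1≤b (<⇒≤ b<c) , ≤-trans (<⇒≤ c<d) d≤n
    no-valley : Before v b c → Before v d c → ⊥
    no-valley b↑c d↑c = valleyFree 1≤b b<c c<d d≤n (Before⇒≻ b↑c , Before⇒≻ d↑c)
    by-cases : Dec (c ≡ a) → Before v c a
    by-cases (yes refl) = ⊥-elim (no-valley b↑a d↑a)
    by-cases (no c≢a) with Before-total (complete c∈[n]) (complete a∈[n]) c≢a
    ... | inj₁ c↑a = c↑a
    ... | inj₂ a↑c = ⊥-elim (no-valley (Before-trans unique b↑a a↑c) (Before-trans unique d↑a a↑c))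

module FlagOrder {n K} (F : Flag n K) (v : List ℕ) (dv : DefinesOrder F v) where
  open Flag F

  |v|≡n : length v ≡ n
  |v|≡n = proj₁ dv

  ranked : ∀ i → InRange n (lookup v i)
  ranked i = proj₁ (proj₂ dv i)

  ∈X-suc : ∀ i → T (X (suc (toℕ i)) (lookup v i))
  ∈X-suc i = proj₁ (proj₂ (proj₂ dv i))

  ∉X : ∀ i → ¬ T (X (toℕ i) (lookup v i))
  ∉X i = proj₂ (proj₂ (proj₂ dv i))

  position<n : ∀ (i : Fin (length v)) → toℕ i < n
  position<n i = subst (toℕ i <_) |v|≡n (toℕ<n i)

  X-mono : ∀ {x k m} → InRange n x → k ≤ m → m ≤ n → T (X k x) → T (X m x)
  X-mono {m = zero} _ z≤n _ x∈Xk = x∈Xk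
  X-mono {m = suc m} x∈[n] k≤m m<n x∈Xk with m≤n⇒m<n∨m≡n k≤m
  ... | inj₁ (s≤s k≤m) = chain m _ m<n x∈[n] (X-mono x∈[n] k≤m (<⇒≤ m<n) x∈Xk)
  ... | inj₂ refl = x∈Xk

  <⇒∈X : ∀ i {k} → toℕ i < k → k ≤ n → T (X k (lookup v i))
  <⇒∈X i i<k k≤n = X-mono (ranked i) i<k k≤n (∈X-suc i)

  ∈X⇒< : ∀ i {k} → T (X k (lookup v i)) → toℕ i < k
  ∈X⇒< i vi∈Xk = ≰⇒> λ k≤i → ∉X i (X-mono (ranked i) k≤i (<⇒≤ (position<n i)) vi∈Xk)

  unique : Unique v
  unique = lookup-injective⇒Unique v λ i j i<j vi≡vj →
    <⇒≱ i<j (≤-pred (∈X⇒< j (subst (T ∘ X (suc (toℕ i))) vi≡vj (∈X-suc i))))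

  isLinOrder : IsLinOrder n v
  isLinOrder = unique∧length⇒IsLinOrder unique
    (λ x∈v → subst (InRange n) (sym (lookup-index x∈v)) (ranked (index x∈v))) |v|≡n

  between⇒ranked-above : ∀ p q r → White n K (lookup v r) →
    lookup v p < lookup v r → lookup v r < lookup v q → toℕ r ≤ toℕ p ⊔ toℕ q
  between⇒ranked-above p q r r-white vp<vr vr<vq = ≤-pred (∈X⇒< r vr∈Xm)
    where
    m≤n : suc (toℕ p ⊔ toℕ q) ≤ n
    m≤n = ⊔-lub (position<n p) (position<n q)
    vr∈Xm : T (X (suc (toℕ p ⊔ toℕ q)) (lookup v r))
    vr∈Xm = proj₂ (proj₂ (convex _ z<s m≤n)) _ _ _ vp<vr vr<vq (ranked p) (ranked q)
      (<⇒∈X p (s≤s (m≤m⊔n _ _)) m≤n) (<⇒∈X q (s≤s (m≤n⊔m _ _)) m≤n) r-white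

flagOrder-valleyFree : ∀ {n v} (F : Flag n (Kfull n)) → DefinesOrder F v → ValleyFree n v
flagOrder-valleyFree {n} {v} F dv _ i<j j<k _ (i≻j , k≻j)
  with p , r , p<r , refl , refl ← Before⇒positions (≻⇒Before i≻j)
     | q , r′ , q<r′ , refl , vr′≡vr ← Before⇒positions (≻⇒Before k≻j) =
  [ (λ p⊔q≡p → <⇒≱ p<r (subst (toℕ r ≤_) p⊔q≡p (ranked-above r refl)))
  , (λ p⊔q≡q → <⇒≱ q<r′ (subst (toℕ r′ ≤_) p⊔q≡q (ranked-above r′ vr′≡vr)))
  ]′ (⊔-sel (toℕ p) (toℕ q))
  where
  open FlagOrder F v dv
  ranked-above : ∀ s → lookup v s ≡ lookup v r → toℕ s ≤ toℕ p ⊔ toℕ q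
  ranked-above s vs≡vr = between⇒ranked-above p q s (Kfull-white (ranked s))
    (subst (lookup v p <_) (sym vs≡vr) i<j) (subst (_< lookup v q) (sym vs≡vr) j<k)

AxisConvex : List ℕ → Set
AxisConvex xs = ∀ {b c d} → b < c → c < d → b ∈ xs → d ∈ xs → c ∈ xs

convex⇒↭range : ∀ {xs y} → Unique xs → AxisConvex xs → y ∈ xs → ∃[ a ] xs ↭ range a (length xs)
convex⇒↭range {xs} {y} uxs convex y∈xs = lo , subst (λ m → xs ↭ range lo m) (sym |xs|≡) xs↭range
  where
  open Extrema using (min; max; argmin-all; argmax-all; min≤xs; xs≤max)
  lo = min y xs
  hi = max y xs
  lo∈xs : lo ∈ xs
  lo∈xs = argmin-all id y∈xs (All.tabulate (λ x∈ → x∈))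
  hi∈xs : hi ∈ xs
  hi∈xs = argmax-all id y∈xs (All.tabulate (λ x∈ → x∈))
  lo≤ : ∀ {x} → x ∈ xs → lo ≤ x
  lo≤ = All.lookup (min≤xs y xs)
  ≤hi : ∀ {x} → x ∈ xs → x ≤ hi
  ≤hi = All.lookup (xs≤max y xs)
  lo+len≡ : lo + (suc hi ∸ lo) ≡ suc hi
  lo+len≡ = m+[n∸m]≡n (≤-trans (lo≤ hi∈xs) (n≤1+n hi))
  between : ∀ {x} → lo ≤ x → x ≤ hi → x ∈ xs
  between lo≤x x≤hi with m≤n⇒m<n∨m≡n lo≤x | m≤n⇒m<n∨m≡n x≤hi
  ... | inj₂ refl | _ = lo∈xs
  ... | _ | inj₂ refl = hi∈xs
  ... | inj₁ lo<x | inj₁ x<hi = convex lo<x x<hi lo∈xs hi∈xs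
  xs↭range : xs ↭ range lo (suc hi ∸ lo)
  xs↭range = ⊆∧⊇⇒↭ uxs (range-unique lo _)
    (λ {x} x∈xs → ∈-range⁺ lo _ (lo≤ x∈xs) (subst (x <_) (sym lo+len≡) (s≤s (≤hi x∈xs))))
    (λ {x} x∈range → let lo≤x , x<hi+1 = ∈-range⁻ lo _ x∈range in
      between lo≤x (≤-pred (subst (x <_) lo+len≡ x<hi+1)))
  |xs|≡ : length xs ≡ suc hi ∸ lo
  |xs|≡ = trans (↭-length xs↭range) (length-range lo _)

module PrefixFlag {n v} (2≤n : 2 ≤ n) (lin : IsLinOrder n v) (valleyFree : ValleyFree n v) where
  open LinOrder lin

  prefix-convex : ∀ m → AxisConvex (take m v)
  prefix-convex m {b} {c} {d} b<c c<d b∈ d∈ = [ (λ c∈take → c∈take) , (⊥-elim ∘ no-valley) ]′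
    (∈-++⁻ (take m v) (subst (c ∈_) (sym (take++drop≡id m v)) (complete c∈[n])))
    where
    1≤b = proj₁ (inRange (take-⊆ m v b∈))
    d≤n = proj₂ (inRange (take-⊆ m v d∈))
    c∈[n] : InRange n c
    c∈[n] = ≤-trans 1≤b (<⇒≤ b<c) , ≤-trans (<⇒≤ c<d) d≤n
    no-valley : c ∉ drop m v
    no-valley c∈drop = valleyFree 1≤b b<c c<d d≤n
      (Before⇒≻ (take-drop⇒Before m v b∈ c∈drop) , Before⇒≻ (take-drop⇒Before m v d∈ c∈drop))

  length-prefix : ∀ {k} → k ≤ n → length (take k v) ≡ k
  length-prefix {k} k≤n = trans (length-take k v) (trans (cong (k ⊓_) length≡) (m≤n⇒m⊓n≡m k≤n))

  prefix↭range : ∀ k → 1 ≤ k → k ≤ n → ∃[ s ] s + k ≤ n × take k v ↭ range (suc s) k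
  prefix↭range (suc k) _ k<n =
    shift-down a (subst (λ m → take (suc k) v ↭ range a m) (length-prefix k<n) prefix↭)
    where
    0<|v| : 0 < length v
    0<|v| = subst (0 <_) (sym length≡) (≤-trans (s≤s z≤n) k<n)
    head∈prefix : lookup v (fromℕ< 0<|v|) ∈ take (suc k) v
    head∈prefix = lookup∈take v _ (subst (_< suc k) (sym (toℕ-fromℕ< 0<|v|)) z<s)
    interval : ∃[ a ] take (suc k) v ↭ range a (length (take (suc k) v))
    interval = convex⇒↭range (Unique.take⁺ (suc k) unique) (prefix-convex (suc k)) head∈prefix
    a = proj₁ interval
    prefix↭ = proj₂ interval
    member : ∀ {a x} → take (suc k) v ↭ range a (suc k) → a ≤ x → x < a + suc k → InRange n x
    member prefix↭ a≤x x<a+k =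
      inRange (take-⊆ (suc k) v (∈-resp-↭ (↭-sym prefix↭) (∈-range⁺ _ _ a≤x x<a+k)))
    shift-down : ∀ a → take (suc k) v ↭ range a (suc k) →
      ∃[ s ] s + suc k ≤ n × take (suc k) v ↭ range (suc s) (suc k)
    shift-down zero prefix↭ = contradiction (proj₁ (member prefix↭ ≤-refl z<s)) λ ()
    shift-down (suc s) prefix↭ =
      s , subst (_≤ n) (sym (+-suc s k)) (proj₂ (member prefix↭ (m≤m+n (suc s) k) (+-monoʳ-< (suc s) ≤-refl))) ,
      prefix↭

  X : ℕ → SubsetN
  X k x = isYes (x ∈? take k v)

  ∈X⇔ : ∀ {k x} → T (X k x) ⇔ x ∈ take k v
  ∈X⇔ {k} {x} = mk⇔ (toWitness {a? = x ∈? take k v}) (fromWitness {a? = x ∈? take k v})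

  size : ∀ k → 1 ≤ k → k ≤ n → card n (X k) ≡ k
  size k _ k≤n = trans (↭-length filter↭prefix) (length-prefix k≤n)
    where
    P? = λ x → T? (X k x)
    filter↭prefix : filter P? [ n ] ↭ take k v
    filter↭prefix = ⊆∧⊇⇒↭ (Unique.filter⁺ P? ([n]-unique n)) (Unique.take⁺ k unique)
      (λ x∈ → Equivalence.to ∈X⇔ (proj₂ (∈-filter⁻ P? {xs = [ n ]} x∈)))
      (λ x∈ → ∈-filter⁺ P? (∈[n]⁺ (inRange (take-⊆ k v x∈))) (Equivalence.from ∈X⇔ x∈))

  wconvex : ∀ k → 1 ≤ k → k ≤ n → IsWConvex n (Kfull n) (X k)
  wconvex k 1≤k k≤n with s , s+k≤n , prefix↭ ← prefix↭range k 1≤k k≤n =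
    arc , (λ (_ , black , _) → Kfull-noBlack black) ,
    λ _ _ _ i<j j<l _ _ i∈ l∈ _ →
      Equivalence.from ∈X⇔ (prefix-convex k i<j j<l (Equivalence.to ∈X⇔ i∈) (Equivalence.to ∈X⇔ l∈))
    where
    window≡range : window (necklace n (Kfull n)) s k ≡ range (suc s) k
    window≡range =
      trans (cong (λ c → window c s k) (necklace-Kfull n 2≤n)) (take-drop-range 1 n s k (range 1 n) s+k≤n)
    arc : IsArc n (Kfull n) (X k)
    arc = s , k , <-≤-trans (m<m+n s 1≤k) s+k≤n , k≤n , λ x _ →
      (λ x∈X → subst (x ∈_) (sym window≡range) (∈-resp-↭ prefix↭ (Equivalence.to ∈X⇔ x∈X))) ,
      (λ x∈window →
        Equivalence.from ∈X⇔ (∈-resp-↭ (↭-sym prefix↭) (subst (x ∈_) window≡range x∈window)))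

  flag : Flag n (Kfull n)
  flag = record
    { X = X
    ; empty₀ = λ _ → refl
    ; chain = λ k _ _ _ → Equivalence.from ∈X⇔ ∘ take-mono v (n≤1+n k) ∘ Equivalence.to ∈X⇔
    ; size = size
    ; convex = wconvex
    ; full = λ x x∈[n] →
        Equivalence.from ∈X⇔ (subst (x ∈_) (sym (take-all n v (≤-reflexive length≡))) (complete x∈[n]))
    }

  definesOrder : DefinesOrder flag v
  definesOrder = length≡ , λ i →
    inRange (∈-lookup i) ,
    Equivalence.from ∈X⇔ (lookup∈take v i ≤-refl) ,
    lookup∉take unique i ∘ Equivalence.to ∈X⇔

InD-Kfull⇔ValleyFree : ∀ {n v} → 2 ≤ n → InD n (Kfull n) v ⇔ (IsLinOrder n v × ValleyFree n v)
InD-Kfull⇔ValleyFree {v = v} 2≤n = mk⇔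
  (λ (F , dv) → FlagOrder.isLinOrder F v dv , flagOrder-valleyFree F dv)
  (λ (lin , valleyFree) → PrefixFlag.flag 2≤n lin valleyFree , PrefixFlag.definesOrder 2≤n lin valleyFree)

proposition2 : ∀ n → 3 ≤ n →
    (∀ (v : List ℕ) → InD n (Kfull n) v ⇔ InFishburn n (Kfull n) v) ×
    (∀ (v : List ℕ) → InFishburn n (Kfull n) v ⇔ SinglePeaked n v)
proposition2 n 3≤n =
  (λ v → ⇔.trans (InD-Kfull⇔ValleyFree 2≤n) (⇔.sym InFishburn-Kfull⇔ValleyFree)) ,
  (λ v → ⇔.trans InFishburn-Kfull⇔ValleyFree (⇔.sym SinglePeaked⇔ValleyFree))
  where
  2≤n : 2 ≤ n
  2≤n = ≤-trans (n≤1+n 2) 3≤n
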